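{- If $G$ and $H$ are $n$-vertex $r$-regular graphs, then $G\equiv H$.
   Context: Graphs are finite and simple. A hypergraph $G=(V,X)$ consists of a finite vertex set $V$ and a family $X$ of subsets of $V$; graphs are the $2$-uniform hypergraphs. If $G$ has $n$ vertices and $m\ge1$ hyperedges, its vertex-hyperedge incidence matrix $M_G\in\{0,1\}^{n\times m}$ has $(i,j)$ entry $1$ iff vertex $i$ belongs to hyperedge $j$. A doubly stochastic matrix is a square nonnegative matrix whose rows and columns each sum to $1$. For hypergraphs $G,H$, write $G\equiv H$ if either $G$ and $H$ have the same number of vertices and no hyperedges, or there exist doubly stochastic matrices $S_1,S_2$ with $S_1M_G=M_HS_2^t$ and $M_GS_2=S_1^tM_H$. -}

module Defs where

open import Data.Nat using (ℕ; zero; suc)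
open import Data.Fin using (Fin; zero; suc)
open import Data.Fin.Subset using (Subset; ∣_∣)
open import Data.Vec using (lookup)
open import Data.Bool using (Bool; true; false; if_then_else_)
open import Data.Rational using (ℚ; 0ℚ; 1ℚ; _+_; _*_; _≤_)
open import Data.Product using (Σ; _×_; _,_)
open import Data.Sum using (_⊎_)
open import Relation.Binary.PropositionalEquality using (_≡_)

sumℕ : ∀ k → (Fin k → ℕ) → ℕ
sumℕ zero    f = 0
sumℕ (suc k) f = f zero Data.Nat.+ sumℕ k (λ i → f (suc i))

sumℚ : ∀ k → (Fin k → ℚ) → ℚ
sumℚ zero    f = 0ℚ
sumℚ (suc k) f = f zero + sumℚ k (λ i → f (suc i))

record Hypergraph (n : ℕ) : Set where
  field
    nEdges : ℕ
    edge   : Fin nEdges → Subset n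
open Hypergraph public

-- A (finite simple) graph: 2-uniform, no repeated edges
IsGraph : ∀ {n} → Hypergraph n → Set
IsGraph G = (∀ j → ∣ edge G j ∣ ≡ 2)
          × (∀ i j → edge G i ≡ edge G j → i ≡ j)

degree : ∀ {n} (G : Hypergraph n) → Fin n → ℕ
degree G v = sumℕ (nEdges G) (λ j → if lookup (edge G j) v then 1 else 0)

IsRegular : ∀ {n} → ℕ → Hypergraph n → Set
IsRegular r G = ∀ v → degree G v ≡ r

Mat : ℕ → ℕ → Set
Mat a b = Fin a → Fin b → ℚ

_·_ : ∀ {a b c} → Mat a b → Mat b c → Mat a c
(A · B) i k = sumℚ _ (λ j → A i j * B j k)

transpose : ∀ {a b} → Mat a b → Mat b a
transpose A j i = A i j

incidence : ∀ {n} (G : Hypergraph n) → Mat n (nEdges G)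
incidence G v j = if lookup (edge G j) v then 1ℚ else 0ℚ

DoublyStochastic : ∀ {a b} → Mat a b → Set
DoublyStochastic {a} {b} S =
  (a ≡ b) × (∀ i j → 0ℚ ≤ S i j)
  × (∀ i → sumℚ b (S i) ≡ 1ℚ) × (∀ j → sumℚ a (λ i → S i j) ≡ 1ℚ)

MatEq : ∀ {a b} → Mat a b → Mat a b → Set
MatEq A B = ∀ i j → A i j ≡ B i j

_≃ₕ_ : ∀ {n₁ n₂} → Hypergraph n₁ → Hypergraph n₂ → Set
_≃ₕ_ {n₁} {n₂} G H =
  ((n₁ ≡ n₂) × (nEdges G ≡ 0) × (nEdges H ≡ 0))
  ⊎ Σ (Mat n₂ n₁) (λ S₁ → Σ (Mat (nEdges G) (nEdges H)) (λ S₂ →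
      DoublyStochastic S₁ × DoublyStochastic S₂
      × MatEq (S₁ · incidence G) (incidence H · transpose S₂)
      × MatEq (incidence G · S₂) (transpose S₁ · incidence H)))

-- The averaging matrices S₁ = J/n and S₂ = J/m witness the equivalence, where m is the common
-- number of edges (equal for G and H by double counting, m·2 = n·r). Indeed S₁ M_G has every
-- entry 2/n, because every column of M_G sums to the edge size 2, and M_H S₂ᵗ has every entry r/m,
-- because every row of M_H sums to the degree r; these agree since m·2 = n·r. The second identity
-- is symmetric, and the argument works verbatim for uniform regular hypergraphs.
{-# OPTIONS --safe #-}
module Submission where

open import Data.Nat using (ℕ; zero; suc)
import Data.Nat as ℕ
import Data.Nat.Properties as ℕ
open import Data.Fin using (Fin; zero; suc)
open import Data.Fin.Subset using (Subset; ∣_∣)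
open import Data.Vec using ([]; _∷_; lookup)
open import Data.Bool using (true; false; if_then_else_)
open import Data.Rational using (ℚ; 0ℚ; 1ℚ; _+_; _*_; _≤_; 1/_; NonZero; Positive; NonNegative)
import Data.Rational.Properties as ℚ
open import Data.Rational.Solver using (module +-*-Solver)
open import Data.Product using (_,_)
open import Data.Sum using (inj₁; inj₂)
open import Relation.Binary.PropositionalEquality
open ≡-Reasoning
open import Algebra.Properties.CommutativeSemigroup ℕ.+-commutativeSemigroup using (interchange)

open import Defs

sumℕ-cong : ∀ k {f g : Fin k → ℕ} → (∀ i → f i ≡ g i) → sumℕ k f ≡ sumℕ k g
sumℕ-cong zero    f≗g = refl
sumℕ-cong (suc k) f≗g = cong₂ ℕ._+_ (f≗g zero) (sumℕ-cong k (λ i → f≗g (suc i)))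

sumℕ-zero : ∀ k → sumℕ k (λ _ → 0) ≡ 0
sumℕ-zero zero    = refl
sumℕ-zero (suc k) = sumℕ-zero k

sumℕ-const : ∀ k c → sumℕ k (λ _ → c) ≡ k ℕ.* c
sumℕ-const zero    c = refl
sumℕ-const (suc k) c = cong (c ℕ.+_) (sumℕ-const k c)

sumℕ-+ : ∀ k (f g : Fin k → ℕ) → sumℕ k (λ i → f i ℕ.+ g i) ≡ sumℕ k f ℕ.+ sumℕ k g
sumℕ-+ zero    f g = refl
sumℕ-+ (suc k) f g = begin
  f zero ℕ.+ g zero ℕ.+ sumℕ k (λ i → f (suc i) ℕ.+ g (suc i))
    ≡⟨ cong (f zero ℕ.+ g zero ℕ.+_) (sumℕ-+ k _ _) ⟩
  f zero ℕ.+ g zero ℕ.+ (sumℕ k (λ i → f (suc i)) ℕ.+ sumℕ k (λ i → g (suc i)))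
    ≡⟨ interchange (f zero) (g zero) _ _ ⟩
  f zero ℕ.+ sumℕ k (λ i → f (suc i)) ℕ.+ (g zero ℕ.+ sumℕ k (λ i → g (suc i))) ∎

sumℕ-swap : ∀ a b (f : Fin a → Fin b → ℕ) →
  sumℕ a (λ i → sumℕ b (f i)) ≡ sumℕ b (λ j → sumℕ a (λ i → f i j))
sumℕ-swap zero    b f = sym (sumℕ-zero b)
sumℕ-swap (suc a) b f = begin
  sumℕ b (f zero) ℕ.+ sumℕ a (λ i → sumℕ b (f (suc i)))
    ≡⟨ cong (sumℕ b (f zero) ℕ.+_) (sumℕ-swap a b (λ i → f (suc i))) ⟩
  sumℕ b (f zero) ℕ.+ sumℕ b (λ j → sumℕ a (λ i → f (suc i) j))
    ≡⟨ sym (sumℕ-+ b (f zero) _) ⟩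
  sumℕ b (λ j → f zero j ℕ.+ sumℕ a (λ i → f (suc i) j)) ∎

∣p∣≡sumℕ : ∀ {n} (p : Subset n) → ∣ p ∣ ≡ sumℕ n (λ v → if lookup p v then 1 else 0)
∣p∣≡sumℕ []          = refl
∣p∣≡sumℕ (true ∷ p)  = cong suc (∣p∣≡sumℕ p)
∣p∣≡sumℕ (false ∷ p) = ∣p∣≡sumℕ p

-- The cast ℕ → ℚ, defined so that sums of constants unfold to it directly.
ι : ℕ → ℚ
ι k = sumℚ k (λ _ → 1ℚ)

ι-+ : ∀ a b → ι (a ℕ.+ b) ≡ ι a + ι b
ι-+ zero    b = sym (ℚ.+-identityˡ (ι b))
ι-+ (suc a) b = trans (cong (1ℚ +_) (ι-+ a b)) (sym (ℚ.+-assoc 1ℚ (ι a) (ι b)))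

ι-* : ∀ a b → ι (a ℕ.* b) ≡ ι a * ι b
ι-* zero    b = sym (ℚ.*-zeroˡ (ι b))
ι-* (suc a) b = begin
  ι (b ℕ.+ a ℕ.* b)     ≡⟨ ι-+ b (a ℕ.* b) ⟩
  ι b + ι (a ℕ.* b)     ≡⟨ cong₂ _+_ (sym (ℚ.*-identityˡ (ι b))) (ι-* a b) ⟩
  1ℚ * ι b + ι a * ι b  ≡⟨ sym (ℚ.*-distribʳ-+ (ι b) 1ℚ (ι a)) ⟩
  (1ℚ + ι a) * ι b      ∎

ι-nonNegative : ∀ k → NonNegative (ι k)
ι-nonNegative zero    = _
ι-nonNegative (suc k) = ℚ.nonNeg+nonNeg⇒nonNeg 1ℚ (ι k) {{ι-nonNegative k}}

ι-suc-positive : ∀ k → Positive (ι (suc k))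
ι-suc-positive k = ℚ.pos+nonNeg⇒pos 1ℚ (ι k) {{ι-nonNegative k}}

ι-suc-nonZero : ∀ k → NonZero (ι (suc k))
ι-suc-nonZero k = ℚ.pos⇒nonZero (ι (suc k)) {{ι-suc-positive k}}

1/ι-suc : ℕ → ℚ
1/ι-suc k = (1/ ι (suc k)) {{ι-suc-nonZero k}}

if-ι : ∀ b → (if b then 1ℚ else 0ℚ) ≡ ι (if b then 1 else 0)
if-ι true  = sym (ℚ.+-identityʳ 1ℚ)
if-ι false = refl

sumℚ-cong : ∀ k {f g : Fin k → ℚ} → (∀ i → f i ≡ g i) → sumℚ k f ≡ sumℚ k g
sumℚ-cong zero    f≗g = refl
sumℚ-cong (suc k) f≗g = cong₂ _+_ (f≗g zero) (sumℚ-cong k (λ i → f≗g (suc i)))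

sumℚ-const : ∀ k c → sumℚ k (λ _ → c) ≡ ι k * c
sumℚ-const zero    c = sym (ℚ.*-zeroˡ c)
sumℚ-const (suc k) c = begin
  c + sumℚ k (λ _ → c)  ≡⟨ cong₂ _+_ (sym (ℚ.*-identityˡ c)) (sumℚ-const k c) ⟩
  1ℚ * c + ι k * c      ≡⟨ sym (ℚ.*-distribʳ-+ c 1ℚ (ι k)) ⟩
  (1ℚ + ι k) * c        ∎

sumℚ-*ˡ : ∀ k c (f : Fin k → ℚ) → sumℚ k (λ i → c * f i) ≡ c * sumℚ k f
sumℚ-*ˡ zero    c f = sym (ℚ.*-zeroʳ c)
sumℚ-*ˡ (suc k) c f = trans (cong (c * f zero +_) (sumℚ-*ˡ k c (λ i → f (suc i))))
                            (sym (ℚ.*-distribˡ-+ c (f zero) _))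

sumℚ-*ʳ : ∀ k c (f : Fin k → ℚ) → sumℚ k (λ i → f i * c) ≡ sumℚ k f * c
sumℚ-*ʳ k c f = begin
  sumℚ k (λ i → f i * c)  ≡⟨ sumℚ-cong k (λ i → ℚ.*-comm (f i) c) ⟩
  sumℚ k (λ i → c * f i)  ≡⟨ sumℚ-*ˡ k c f ⟩
  c * sumℚ k f            ≡⟨ ℚ.*-comm c _ ⟩
  sumℚ k f * c            ∎

sumℚ-ι : ∀ k (f : Fin k → ℕ) → sumℚ k (λ i → ι (f i)) ≡ ι (sumℕ k f)
sumℚ-ι zero    f = refl
sumℚ-ι (suc k) f = trans (cong (ι (f zero) +_) (sumℚ-ι k (λ i → f (suc i))))
                         (sym (ι-+ (f zero) _))

cross-mult⇒1/-equal : ∀ a b x y .{{_ : NonZero a}} .{{_ : NonZero b}} →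
                      b * x ≡ a * y → 1/ a * x ≡ y * 1/ b
cross-mult⇒1/-equal a b x y bx≡ay = begin
  1/ a * x                  ≡⟨ sym (ℚ.*-identityʳ _) ⟩
  1/ a * x * 1ℚ             ≡⟨ cong (1/ a * x *_) (sym (ℚ.*-inverseʳ b)) ⟩
  1/ a * x * (b * 1/ b)     ≡⟨ solve 4 (λ A X B C → A :* X :* (B :* C) := A :* (B :* X) :* C)
                                 refl (1/ a) x b (1/ b) ⟩
  1/ a * (b * x) * 1/ b     ≡⟨ cong (λ z → 1/ a * z * 1/ b) bx≡ay ⟩
  1/ a * (a * y) * 1/ b     ≡⟨ solve 4 (λ A P Y C → A :* (P :* Y) :* C := (A :* P) :* (Y :* C))
                                 refl (1/ a) a y (1/ b) ⟩
  (1/ a * a) * (y * 1/ b)   ≡⟨ cong (_* (y * 1/ b)) (ℚ.*-inverseˡ a) ⟩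
  1ℚ * (y * 1/ b)           ≡⟨ ℚ.*-identityˡ _ ⟩
  y * 1/ b                  ∎
  where open +-*-Solver

IsUniform : ∀ {n} → ℕ → Hypergraph n → Set
IsUniform k G = ∀ j → ∣ edge G j ∣ ≡ k

degree-sum≡size-sum : ∀ {n} (G : Hypergraph n) →
                      sumℕ n (degree G) ≡ sumℕ (nEdges G) (λ j → ∣ edge G j ∣)
degree-sum≡size-sum {n} G = begin
  sumℕ n (degree G)
    ≡⟨ sym (sumℕ-swap (nEdges G) n _) ⟩
  sumℕ (nEdges G) (λ j → sumℕ n (λ v → if lookup (edge G j) v then 1 else 0))
    ≡⟨ sumℕ-cong (nEdges G) (λ j → sym (∣p∣≡sumℕ (edge G j))) ⟩
  sumℕ (nEdges G) (λ j → ∣ edge G j ∣) ∎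

handshake : ∀ {n} k r (G : Hypergraph n) → IsUniform k G → IsRegular r G →
                         nEdges G ℕ.* k ≡ n ℕ.* r
handshake {n} k r G uniform regular = begin
  nEdges G ℕ.* k                         ≡⟨ sym (sumℕ-const (nEdges G) k) ⟩
  sumℕ (nEdges G) (λ _ → k)              ≡⟨ sumℕ-cong (nEdges G) (λ j → sym (uniform j)) ⟩
  sumℕ (nEdges G) (λ j → ∣ edge G j ∣)   ≡⟨ sym (degree-sum≡size-sum G) ⟩
  sumℕ n (degree G)                      ≡⟨ sumℕ-cong n regular ⟩
  sumℕ n (λ _ → r)                       ≡⟨ sumℕ-const n r ⟩
  n ℕ.* r                                ∎

incidence-column-sum : ∀ {n} (G : Hypergraph n) j →
                       sumℚ n (λ v → incidence G v j) ≡ ι ∣ edge G j ∣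
incidence-column-sum {n} G j = begin
  sumℚ n (λ v → incidence G v j)
    ≡⟨ sumℚ-cong n (λ v → if-ι (lookup (edge G j) v)) ⟩
  sumℚ n (λ v → ι (if lookup (edge G j) v then 1 else 0))
    ≡⟨ sumℚ-ι n _ ⟩
  ι (sumℕ n (λ v → if lookup (edge G j) v then 1 else 0))
    ≡⟨ cong ι (sym (∣p∣≡sumℕ (edge G j))) ⟩
  ι ∣ edge G j ∣ ∎

incidence-row-sum : ∀ {n} (G : Hypergraph n) v →
                    sumℚ (nEdges G) (incidence G v) ≡ ι (degree G v)
incidence-row-sum G v =
  trans (sumℚ-cong (nEdges G) (λ j → if-ι (lookup (edge G j) v))) (sumℚ-ι (nEdges G) _)

constMat : ∀ {a b} → ℚ → Mat a b
constMat c _ _ = c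

constMat-·-incidence : ∀ {n a} c (G : Hypergraph n) (u : Fin a) j →
                       (constMat c · incidence G) u j ≡ c * ι ∣ edge G j ∣
constMat-·-incidence {n} c G u j =
  trans (sumℚ-*ˡ n c (λ v → incidence G v j)) (cong (c *_) (incidence-column-sum G j))

incidence-·-constMat : ∀ {n a} c (G : Hypergraph n) v (l : Fin a) →
                       (incidence G · constMat c) v l ≡ ι (degree G v) * c
incidence-·-constMat c G v l =
  trans (sumℚ-*ʳ (nEdges G) c (incidence G v)) (cong (_* c) (incidence-row-sum G v))

averaging-doublyStochastic : ∀ {a b} k → a ≡ suc k → b ≡ suc k →
                             DoublyStochastic {a} {b} (constMat (1/ι-suc k))
averaging-doublyStochastic k refl refl =
  refl , (λ _ _ → nonNegative) , (λ _ → sums-to-one) , (λ _ → sums-to-one)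
  where
  nonNegative : 0ℚ ≤ 1/ι-suc k
  nonNegative = ℚ.<⇒≤ (ℚ.positive⁻¹ _ {{ℚ.1/pos⇒pos (ι (suc k)) {{ι-suc-positive k}}}})
  sums-to-one : sumℚ (suc k) (λ _ → 1/ι-suc k) ≡ 1ℚ
  sums-to-one = trans (sumℚ-const (suc k) _) (ℚ.*-inverseʳ (ι (suc k)) {{ι-suc-nonZero k}})

uniform-regular-equivalent⁺ : ∀ n m k r (G H : Hypergraph (suc n)) →
  nEdges G ≡ suc m → nEdges H ≡ suc m →
  IsUniform k G → IsUniform k H → IsRegular r G → IsRegular r H → G ≃ₕ H
uniform-regular-equivalent⁺ n m k r G H mG≡ mH≡ uniformG uniformH regularG regularH =
  inj₂ (constMat c , constMat d ,
        averaging-doublyStochastic n refl refl , averaging-doublyStochastic m mG≡ mH≡ ,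
        left-identity , right-identity)
  where
  c d : ℚ
  c = 1/ι-suc n
  d = 1/ι-suc m
  balance : c * ι k ≡ ι r * d
  balance = cross-mult⇒1/-equal (ι (suc n)) (ι (suc m)) (ι k) (ι r)
    {{ι-suc-nonZero n}} {{ι-suc-nonZero m}} (begin
    ι (suc m) * ι k         ≡⟨ sym (ι-* (suc m) k) ⟩
    ι (suc m ℕ.* k)         ≡⟨ cong (λ e → ι (e ℕ.* k)) (sym mG≡) ⟩
    ι (nEdges G ℕ.* k)      ≡⟨ cong ι (handshake k r G uniformG regularG) ⟩
    ι (suc n ℕ.* r)         ≡⟨ ι-* (suc n) r ⟩
    ι (suc n) * ι r         ∎)
  left-identity : MatEq (constMat c · incidence G) (incidence H · transpose (constMat d))
  left-identity v j = begin
    (constMat c · incidence G) v j   ≡⟨ constMat-·-incidence c G v j ⟩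
    c * ι ∣ edge G j ∣               ≡⟨ cong (λ s → c * ι s) (uniformG j) ⟩
    c * ι k                          ≡⟨ balance ⟩
    ι r * d                          ≡⟨ cong (λ s → ι s * d) (sym (regularH v)) ⟩
    ι (degree H v) * d               ≡⟨ sym (incidence-·-constMat d H v j) ⟩
    (incidence H · constMat d) v j   ∎
  right-identity : MatEq (incidence G · constMat d) (transpose (constMat c) · incidence H)
  right-identity v l = begin
    (incidence G · constMat d) v l   ≡⟨ incidence-·-constMat d G v l ⟩
    ι (degree G v) * d               ≡⟨ cong (λ s → ι s * d) (regularG v) ⟩
    ι r * d                          ≡⟨ sym balance ⟩
    c * ι k                          ≡⟨ cong (λ s → c * ι s) (sym (uniformH l)) ⟩
    c * ι ∣ edge H l ∣               ≡⟨ sym (constMat-·-incidence c H v l) ⟩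
    (constMat c · incidence H) v l   ∎

-- Edges must be nonempty: otherwise double counting does not force equal edge counts.
uniform-regular-equivalent : ∀ {n} k r (G H : Hypergraph n) →
  IsUniform (suc k) G → IsUniform (suc k) H → IsRegular r G → IsRegular r H → G ≃ₕ H
uniform-regular-equivalent {zero} k r G H uniformG uniformH regularG regularH =
  inj₁ (refl , edgeless G uniformG regularG , edgeless H uniformH regularH)
  where
  edgeless : ∀ K → IsUniform (suc k) K → IsRegular r K → nEdges K ≡ 0
  edgeless K uniformK regularK =
    ℕ.m*n≡0⇒m≡0 (nEdges K) (suc k) (handshake (suc k) r K uniformK regularK)
uniform-regular-equivalent {suc n} k r G H uniformG uniformH regularG regularH =
  by-edge-count (nEdges G) refl
  where
  nEdgesG≡nEdgesH : nEdges G ≡ nEdges H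
  nEdgesG≡nEdgesH = ℕ.*-cancelʳ-≡ (nEdges G) (nEdges H) (suc k)
    (trans (handshake (suc k) r G uniformG regularG)
           (sym (handshake (suc k) r H uniformH regularH)))
  by-edge-count : ∀ m → nEdges G ≡ m → G ≃ₕ H
  by-edge-count zero    mG≡0 = inj₁ (refl , mG≡0 , trans (sym nEdgesG≡nEdgesH) mG≡0)
  by-edge-count (suc m) mG≡m = uniform-regular-equivalent⁺ n m (suc k) r G H
    mG≡m (trans (sym nEdgesG≡nEdgesH) mG≡m) uniformG uniformH regularG regularH

mainTheorem4 : (n r : ℕ) (G H : Hypergraph n) → IsGraph G → IsGraph H
    → IsRegular r G → IsRegular r H → G ≃ₕ H
mainTheorem4 n r G H (uniformG , _) (uniformH , _) =
  uniform-regular-equivalent 1 r G H uniformG uniformH
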